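{- For every $k\in\mathbb N$, the problem $\mathrm{ACC}_{\mathbb N}^k$ is not $k$-guessable.
   Context: Problems are partial multivalued functions $f:\subseteq\mathbf X\rightrightarrows\mathbf Y$ between represented spaces; $f$ is computable if it has a computable realizer, where a realizer is a partial $F:\subseteq\mathbb N^{\mathbb N}\to\mathbb N^{\mathbb N}$ mapping every name of every $x\in\operatorname{dom}(f)$ to a name of some element of $f(x)$. The completion $\overline{\mathbf Y}$ of a represented space $\mathbf Y$ is $\mathbf Y\cup\{\bot\}$, where $p\in\mathbb N^{\mathbb N}$ is decoded by deleting all $0$s and subtracting $1$ from the remaining entries; if the result is an infinite sequence naming $y\in\mathbf Y$, then $p$ names $y$, otherwise $p$ names $\bot$. $f:\subseteq\mathbf X\rightrightarrows\mathbf Y$ is $k$-guessable if the problem $\breve f_k:\subseteq\mathbf X\rightrightarrows\overline{\mathbf Y}^k$ with domain $\operatorname{dom}(f)$, where $(y_0,\dots,y_{k-1})\in\breve f_k(x)$ iff $y_i\in f(x)$ for some $i<k$, is computable. $\mathrm{ACC}_{\mathbb N}$ is the problem: given an enumeration of the complement of a set $A\subseteq\mathbb N$ with $|\mathbb N\setminus A|\le1$, return some $n\in A$. $\mathrm{ACC}_{\mathbb N}^k$ is its $k$-fold parallel product (given $k$ instances, return a $k$-tuple of solutions, one for each), with codomain $\mathbb N^k$. -}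

module Defs where

open import Data.Nat using (ℕ; zero; suc; _+_; _*_; _<_; pred)
open import Data.Fin using (Fin; toℕ)
open import Data.Vec using (Vec; []; _∷_; lookup)
open import Data.Maybe using (Maybe; just; nothing)
open import Data.Product using (Σ; _×_; ∃; ∃-syntax)
open import Relation.Binary.PropositionalEquality using (_≡_; _≢_)
open import Relation.Nullary using (¬_)

Baire : Set
Baire = ℕ → ℕ

-- A (partial) realizer F :⊆ ℕ^ℕ → ℕ^ℕ is computable iff there is a code c
-- of a μ-recursive function with oracle such that F(p)(n) = Φ_c^p(n).

data Code : ℕ → Set where
  zeroC   : ∀ {n} → Code n
  succC   : Code 1
  projC   : ∀ {n} → Fin n → Code n
  compC   : ∀ {n m} → Code m → Vec (Code n) m → Code n
  recC    : ∀ {n} → Code n → Code (2 + n) → Code (suc n)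
  muC     : ∀ {n} → Code (suc n) → Code n
  oracleC : Code 1

mutual
  data Eval (p : Baire) : ∀ {n} → Code n → Vec ℕ n → ℕ → Set where
    ezero  : ∀ {n} {xs : Vec ℕ n} → Eval p zeroC xs 0
    esucc  : ∀ {x} → Eval p succC (x ∷ []) (suc x)
    eproj  : ∀ {n} {i : Fin n} {xs} → Eval p (projC i) xs (lookup xs i)
    ecomp  : ∀ {n m} {f : Code m} {gs : Vec (Code n) m} {xs ys z} →
             EvalAll p gs xs ys → Eval p f ys z → Eval p (compC f gs) xs z
    erec0  : ∀ {n} {g : Code n} {h xs z} →
             Eval p g xs z → Eval p (recC g h) (0 ∷ xs) z
    erecS  : ∀ {n} {g : Code n} {h xs y z w} →
             Eval p (recC g h) (y ∷ xs) z → Eval p h (y ∷ z ∷ xs) w →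
             Eval p (recC g h) (suc y ∷ xs) w
    emu    : ∀ {n} {f : Code (suc n)} {xs y} →
             Eval p f (y ∷ xs) 0 →
             (∀ z → z < y → Σ ℕ (λ w → Eval p f (z ∷ xs) (suc w))) →
             Eval p (muC f) xs y
    eoracle : ∀ {x} → Eval p oracleC (x ∷ []) (p x)

  data EvalAll (p : Baire) {n : ℕ} : ∀ {m} → Vec (Code n) m → Vec ℕ n → Vec ℕ m → Set where
    []  : ∀ {xs} → EvalAll p [] xs []
    _∷_ : ∀ {m g z} {gs : Vec (Code n) m} {xs zs} →
          Eval p g xs z → EvalAll p gs xs zs → EvalAll p (g ∷ gs) xs (z ∷ zs)

record RepSpace : Set₁ where
  field
    Carrier : Set
    _names_ : Baire → Carrier → Set
open RepSpace public

record Problem (X Y : RepSpace) : Set₁ where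
  field
    dom : Carrier X → Set
    rel : Carrier X → Carrier Y → Set
open Problem public

Computable : {X Y : RepSpace} → Problem X Y → Set
Computable {X} {Y} f =
  Σ (Code 1) λ c →
    ∀ (x : Carrier X) (p : Baire) → dom f x → (X names p) x →
    Σ Baire λ q → (∀ n → Eval p c (n ∷ []) (q n)) ×
                  Σ (Carrier Y) λ y → rel f x y × (Y names q) y

ℕSpace : RepSpace
ℕSpace = record { Carrier = ℕ ; _names_ = λ p n → p 0 ≡ n }

VecSpace : ℕ → RepSpace → RepSpace
VecSpace k Y = record
  { Carrier = Vec (Carrier Y) k
  ; _names_ = λ p ys → ∀ (i : Fin k) → (Y names (λ n → p (n * k + toℕ i))) (lookup ys i)
  }

countNZ : Baire → ℕ → ℕ
countNZ p zero = 0
countNZ p (suc i) with p i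
... | zero  = countNZ p i
... | suc _ = suc (countNZ p i)

NZAt : Baire → ℕ → ℕ → Set
NZAt p j i = (p i ≢ 0) × (countNZ p i ≡ j)

-- deleting the 0s of p yields an infinite sequence q (after subtracting 1)
Decodes : Baire → Baire → Set
Decodes p q = ∀ j → Σ ℕ λ i → NZAt p j i × (q j ≡ pred (p i))

InfDecode : Baire → Set
InfDecode p = ∀ j → Σ ℕ λ i → NZAt p j i

-- completion: nothing plays the role of ⊥
Completion : RepSpace → RepSpace
Completion Y = record
  { Carrier = Maybe (Carrier Y)
  ; _names_ = namesC
  }
  where
  namesC : Baire → Maybe (Carrier Y) → Set
  namesC p (just y) = Σ Baire λ q → Decodes p q × (Y names q) y
  namesC p nothing  = ¬ InfDecode p

guessProblem : {X Y : RepSpace} (k : ℕ) → Problem X Y →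
               Problem X (VecSpace k (Completion Y))
guessProblem k f = record
  { dom = dom f
  ; rel = λ x ys → Σ (Fin k) λ i → Σ _ λ y → (lookup ys i ≡ just y) × rel f x y
  }

Guessable : {X Y : RepSpace} → ℕ → Problem X Y → Set
Guessable k f = Computable (guessProblem k f)

-- An instance A ⊆ ℕ with |ℕ ∖ A| ≤ 1 is stored by its complement:
-- nothing ↦ ℕ ∖ A = ∅,  just m ↦ ℕ ∖ A = {m}.
-- Names are enumerations of the complement: p i = 0 enumerates nothing,
-- p i = m + 1 enumerates m.
ACCInput : RepSpace
ACCInput = record
  { Carrier = Maybe ℕ
  ; _names_ = λ p c → (∀ i m → p i ≡ suc m → c ≡ just m) ×
                      (∀ m → c ≡ just m → Σ ℕ λ i → p i ≡ suc m)
  }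

InA : Maybe ℕ → ℕ → Set
InA c n = c ≢ just n

ACC : Problem ACCInput ℕSpace
ACC = record { dom = λ _ → ⊤' ; rel = InA }
  where
  open import Data.Unit using () renaming (⊤ to ⊤')

ACC^ : (k : ℕ) → Problem (VecSpace k ACCInput) (VecSpace k ℕSpace)
ACC^ k = record
  { dom = λ xs → ∀ (i : Fin k) → dom ACC (lookup xs i)
  ; rel = λ xs ns → ∀ (i : Fin k) → rel ACC (lookup xs i) (lookup ns i)
  }

{-# OPTIONS --safe #-}
module Submission where

-- A realizer guessing K answers for K instances of ACC_ℕ is defeated by diagonalizing
-- against each guess at its own coordinate. Start with all K complements empty and run the
-- realizer: some guess i is correct, and since it is a genuine value (not ⊥), its i-th
-- coordinate y is already produced after reading a finite prefix of the input. Extend that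
-- prefix by enumerating y into the complement of instance i; guess i is now wrong, and stays
-- wrong on every input with the longer prefix. Each round settles one more coordinate, so
-- after K rounds no guess can be correct.

open import Defs
open import Data.Nat using (ℕ; zero; suc; _+_; _*_; _<_; _≤_; _≤′_; ≤′-refl; ≤′-step; _⊔_; pred; NonZero; s≤s; s≤s⁻¹; _<?_)
open import Data.Nat.Properties hiding (_≟_)
open import Data.Nat.DivMod using (_mod_; _%_; %-remove-+ˡ; m<n⇒m%n≡m)
open import Data.Nat.Divisibility using (n∣m*n)
open import Data.Nat.Induction using (<-wellFounded)
open import Data.Fin using (Fin; toℕ; _≟_)
open import Data.Fin.Properties using (toℕ-injective; toℕ-fromℕ<; toℕ<n)
open import Data.Vec using (Vec; []; _∷_; lookup; tabulate)
open import Data.Vec.Properties using (lookup∘tabulate)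
open import Data.Vec.Functional using (updateAt)
open import Data.Vec.Functional.Properties using (updateAt-updates; updateAt-minimal)
open import Data.Maybe using (Maybe; just; nothing) renaming (map to mapMaybe)
open import Data.Product using (Σ; _×_; _,_; proj₂)
open import Data.Sum using (inj₁; inj₂)
open import Data.Unit using (tt)
open import Data.Empty using (⊥; ⊥-elim)
open import Function using (_∘_; const)
open import Induction.WellFounded using (Acc; acc)
open import Relation.Binary.Definitions using (tri<; tri≈; tri>)
open import Relation.Binary.PropositionalEquality
open import Relation.Nullary using (¬_; yes; no)

Agree : ℕ → Baire → Baire → Set
Agree N p p' = ∀ n → n < N → p n ≡ p' n

agree-≤ : ∀ {M N p p'} → M ≤ N → Agree N p p' → Agree M p p'
agree-≤ M≤N ag n n<M = ag n (<-≤-trans n<M M≤N)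

agree-trans : ∀ {N p p' p''} → Agree N p p' → Agree N p' p'' → Agree N p p''
agree-trans ag ag' n n<N = trans (ag n n<N) (ag' n n<N)

Locally : (Baire → Set) → Baire → Set
Locally P p = Σ ℕ λ N → ∀ p' → Agree N p p' → P p'

locally-map : ∀ {P Q : Baire → Set} {p} → (∀ {p'} → P p' → Q p') → Locally P p → Locally Q p
locally-map f (N , hP) = N , λ p' ag → f (hP p' ag)

locally₂ : ∀ {P Q R : Baire → Set} {p} → (∀ {p'} → P p' → Q p' → R p') →
           Locally P p → Locally Q p → Locally R p
locally₂ f (M , hP) (N , hQ) =
  M ⊔ N , λ p' ag → f (hP p' (agree-≤ (m≤m⊔n M N) ag)) (hQ p' (agree-≤ (m≤n⊔m M N) ag))

locally-∀< : ∀ {P : ℕ → Baire → Set} {p} y →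
             (∀ z → z < y → Locally (P z) p) → Locally (λ p' → ∀ z → z < y → P z p') p
locally-∀< zero    hs = 0 , λ _ _ _ ()
locally-∀< {P} (suc y) hs =
  locally₂ extend (hs y ≤-refl) (locally-∀< y (λ z z<y → hs z (m<n⇒m<1+n z<y)))
  where
  extend : ∀ {p'} → P y p' → (∀ z → z < y → P z p') → ∀ z → z < suc y → P z p'
  extend Py Pbelow z z<1+y with m<1+n⇒m<n∨m≡n z<1+y
  ... | inj₁ z<y  = Pbelow z z<y
  ... | inj₂ refl = Py

mutual
  eval-locally : ∀ {p n} {c : Code n} {xs z} → Eval p c xs z → Locally (λ p' → Eval p' c xs z) p
  eval-locally ezero         = 0 , λ _ _ → ezero
  eval-locally esucc         = 0 , λ _ _ → esucc
  eval-locally eproj         = 0 , λ _ _ → eproj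
  eval-locally (ecomp es e)  = locally₂ ecomp (evalAll-locally es) (eval-locally e)
  eval-locally (erec0 e)     = locally-map erec0 (eval-locally e)
  eval-locally (erecS e₁ e₂) = locally₂ erecS (eval-locally e₁) (eval-locally e₂)
  eval-locally (emu {y = y} e below) =
    locally₂ emu (eval-locally e) (locally-∀< y (λ z z<y → search-locally (below z z<y)))
  eval-locally (eoracle {x}) =
    suc x , λ p' ag → subst (Eval p' oracleC (x ∷ [])) (sym (ag x (n<1+n x))) eoracle

  evalAll-locally : ∀ {p n m} {gs : Vec (Code n) m} {xs zs} →
                    EvalAll p gs xs zs → Locally (λ p' → EvalAll p' gs xs zs) p
  evalAll-locally []       = 0 , λ _ _ → []
  evalAll-locally (e ∷ es) = locally₂ _∷_ (eval-locally e) (evalAll-locally es)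

  search-locally : ∀ {p n} {f : Code (suc n)} {z xs} → Σ ℕ (λ w → Eval p f (z ∷ xs) (suc w)) →
                   Locally (λ p' → Σ ℕ (λ w → Eval p' f (z ∷ xs) (suc w))) p
  search-locally (w , e) = locally-map (w ,_) (eval-locally e)

mutual
  eval-deterministic : ∀ {p n} {c : Code n} {xs z z'} → Eval p c xs z → Eval p c xs z' → z ≡ z'
  eval-deterministic ezero ezero = refl
  eval-deterministic esucc esucc = refl
  eval-deterministic eproj eproj = refl
  eval-deterministic (ecomp es e) (ecomp es' e') with evalAll-deterministic es es'
  ... | refl = eval-deterministic e e'
  eval-deterministic (erec0 e) (erec0 e') = eval-deterministic e e'
  eval-deterministic (erecS e₁ e₂) (erecS e₁' e₂') with eval-deterministic e₁ e₁'
  ... | refl = eval-deterministic e₂ e₂'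
  eval-deterministic (emu {y = y} e below) (emu {y = y'} e' below') with <-cmp y y'
  ... | tri≈ _ y≡y' _ = y≡y'
  ... | tri< y<y' _ _ = ⊥-elim (0≢1+n (eval-deterministic e (proj₂ (below' y y<y'))))
  ... | tri> _ _ y'<y = ⊥-elim (0≢1+n (eval-deterministic e' (proj₂ (below y' y'<y))))
  eval-deterministic eoracle eoracle = refl

  evalAll-deterministic : ∀ {p n m} {gs : Vec (Code n) m} {xs zs zs'} →
                          EvalAll p gs xs zs → EvalAll p gs xs zs' → zs ≡ zs'
  evalAll-deterministic []       []         = refl
  evalAll-deterministic (e ∷ es) (e' ∷ es') =
    cong₂ _∷_ (eval-deterministic e e') (evalAll-deterministic es es')

Computes : Code 1 → Baire → Baire → Set
Computes c p q = ∀ n → Eval p c (n ∷ []) (q n)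

computes-continuous : ∀ {c p q} → Computes c p q → ∀ L →
                      Σ ℕ λ U → ∀ p' q' → Agree U p p' → Computes c p' q' → Agree L q q'
computes-continuous out L =
  let U , h = locally-∀< L (λ n _ → eval-locally (out n))
  in  U , λ p' q' ag out' n n<L → eval-deterministic (h p' ag n n<L) (out' n)

countNZ-suc-nonzero : ∀ p n → p n ≢ 0 → countNZ p (suc n) ≡ suc (countNZ p n)
countNZ-suc-nonzero p n pn≢0 with p n
... | zero  = ⊥-elim (pn≢0 refl)
... | suc _ = refl

countNZ-≤-suc : ∀ p n → countNZ p n ≤ countNZ p (suc n)
countNZ-≤-suc p n with p n
... | zero  = ≤-refl
... | suc _ = n≤1+n _

countNZ-mono : ∀ p {m n} → m ≤′ n → countNZ p m ≤ countNZ p n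
countNZ-mono p ≤′-refl        = ≤-refl
countNZ-mono p (≤′-step m≤′n) = ≤-trans (countNZ-mono p m≤′n) (countNZ-≤-suc p _)

countNZ-strict : ∀ p {m n} → p m ≢ 0 → m < n → countNZ p m < countNZ p n
countNZ-strict p {m} pm≢0 m<n =
  subst (_≤ _) (countNZ-suc-nonzero p m pm≢0) (countNZ-mono p (≤⇒≤′ m<n))

countNZ-agree : ∀ {p p'} n → Agree n p p' → countNZ p n ≡ countNZ p' n
countNZ-agree zero _ = refl
countNZ-agree {p} {p'} (suc n) ag
  with p n | p' n | ag n (n<1+n n) | countNZ-agree n (agree-≤ (n≤1+n n) ag)
... | zero  | .zero    | refl | ih = ih
... | suc _ | .(suc _) | refl | ih = cong suc ih

NZAt-≮ : ∀ {p j a a'} → NZAt p j a → NZAt p j a' → ¬ a < a'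
NZAt-≮ {p} (pa≢0 , count≡j) (_ , count'≡j) a<a' =
  <-irrefl refl (subst₂ _<_ count≡j count'≡j (countNZ-strict p pa≢0 a<a'))

NZAt-unique : ∀ {p j a a'} → NZAt p j a → NZAt p j a' → a ≡ a'
NZAt-unique nz nz' = ≤-antisym (≮⇒≥ (NZAt-≮ nz' nz)) (≮⇒≥ (NZAt-≮ nz nz'))

NZAt-agree : ∀ {p p' j a} → NZAt p j a → Agree (suc a) p p' → NZAt p' j a
NZAt-agree {a = a} (pa≢0 , count≡j) ag =
  (λ p'a≡0 → pa≢0 (trans (ag a (n<1+n a)) p'a≡0)) ,
  trans (sym (countNZ-agree a (agree-≤ (n≤1+n a) ag))) count≡j

decodes-agree : ∀ {p p' r j a} → NZAt p j a → Agree (suc a) p p' → Decodes p' r → r j ≡ pred (p a)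
decodes-agree {p' = p'} {j = j} {a = a} nz ag decodes with decodes j
... | a' , nz' , rj≡ with NZAt-unique {p'} {j} {a} {a'} (NZAt-agree nz ag) nz'
... | refl = trans rj≡ (cong pred (sym (ag a (n<1+n a))))

component : ∀ {K} → Baire → Fin K → Baire
component {K} q j n = q (n * K + toℕ j)

component-agree : ∀ {K q q'} a (j : Fin K) →
                  Agree (suc (a * K + toℕ j)) q q' → Agree (suc a) (component q j) (component q' j)
component-agree {K} a j ag n n<1+a =
  ag _ (s≤s (+-monoˡ-≤ (toℕ j) (*-monoˡ-≤ K (s≤s⁻¹ n<1+a))))

module _ {K : ℕ} (c : Code 1) where

  -- r (toℕ j) is coordinate j of the decoded guess j.
  Forces : ℕ → Baire → Fin K → ℕ → Set
  Forces N p j m = ∀ p' q r → Agree N p p' → Computes c p' q →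
                   Decodes (component q j) r → r (toℕ j) ≡ m

  forces-weaken : ∀ {N N' p p' j m} → Forces N p j m → N ≤ N' → Agree N' p p' → Forces N' p' j m
  forces-weaken forces N≤N' ag p'' q r ag' =
    forces p'' q r (agree-≤ N≤N' (agree-trans ag ag'))

  decoded-guess-forced : ∀ {p q r} (j : Fin K) → Computes c p q → Decodes (component q j) r →
                         Σ ℕ λ U → Forces U p j (r (toℕ j))
  decoded-guess-forced j out decodes with decodes (toℕ j)
  ... | a , nz , rj≡ with computes-continuous out (suc (a * K + toℕ j))
  ... | U , output-agrees =
    U , λ p' q' r' ag out' decodes' →
      trans (decodes-agree nz (component-agree a j (output-agrees p' q' ag out')) decodes') (sym rj≡)

countNothing : ∀ {A : Set} {n} → (Fin n → Maybe A) → ℕ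
countNothing {n = zero}  s = 0
countNothing {n = suc n} s with s Fin.zero
... | nothing = suc (countNothing (s ∘ Fin.suc))
... | just _  = countNothing (s ∘ Fin.suc)

countNothing-updateAt : ∀ {A : Set} {n} (s : Fin n → Maybe A) i {a} → s i ≡ nothing →
                        countNothing (updateAt s i (const (just a))) < countNothing s
countNothing-updateAt s Fin.zero s0≡nothing rewrite s0≡nothing = ≤-refl
countNothing-updateAt s (Fin.suc i) si≡nothing with s Fin.zero
... | nothing = s≤s (countNothing-updateAt (s ∘ Fin.suc) i si≡nothing)
... | just _  = countNothing-updateAt (s ∘ Fin.suc) i si≡nothing

module Diagonal (K : ℕ) .{{_ : NonZero K}} (guesser : Guessable K (ACC^ K)) where

  open Σ guesser renaming (proj₁ to c; proj₂ to realizes)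

  -- nothing: the complement of this instance is still empty;
  -- just (M , m): from position M of the input name on, m is enumerated into the complement.
  State : Set
  State = Fin K → Maybe (ℕ × ℕ)

  enumeration : Maybe (ℕ × ℕ) → Baire
  enumeration nothing        n = 0
  enumeration (just (M , m)) n with n <? M
  ... | yes _ = 0
  ... | no  _ = suc m

  enumeration-below : ∀ {M m n} → n < M → enumeration (just (M , m)) n ≡ 0
  enumeration-below {M} {n = n} n<M with n <? M
  ... | yes _   = refl
  ... | no  n≮M = ⊥-elim (n≮M n<M)

  enumeration-above : ∀ {M m n} → M ≤ n → enumeration (just (M , m)) n ≡ suc m
  enumeration-above {M} {n = n} M≤n with n <? M
  ... | yes n<M = ⊥-elim (<⇒≱ n<M M≤n)
  ... | no  _   = refl

  enumeration-suc : ∀ v {n m} → enumeration v n ≡ suc m → mapMaybe proj₂ v ≡ just m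
  enumeration-suc (just (M , m')) {n} e with n <? M
  ... | no _ = cong just (suc-injective e)

  enumeration-names : ∀ v {p : Baire} (f : ℕ → ℕ) → (∀ i → i ≤ f i) →
                      (∀ i → p i ≡ enumeration v (f i)) → (ACCInput names p) (mapMaybe proj₂ v)
  enumeration-names v {p} f inflationary p≡ =
    (λ i m pi≡ → enumeration-suc v (trans (sym (p≡ i)) pi≡)) , enumerated v p≡
    where
    enumerated : ∀ w → (∀ i → p i ≡ enumeration w (f i)) →
                 ∀ m → mapMaybe proj₂ w ≡ just m → Σ ℕ λ i → p i ≡ suc m
    enumerated (just (M , m)) p≡ .m refl = M , trans (p≡ M) (enumeration-above (inflationary M))

  input : State → Vec (Maybe ℕ) K
  input s = tabulate (mapMaybe proj₂ ∘ s)

  name : State → Baire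
  name s n = enumeration (s (n mod K)) n

  component-mod : ∀ n (t : Fin K) → (n * K + toℕ t) mod K ≡ t
  component-mod n t = toℕ-injective (begin
    toℕ ((n * K + toℕ t) mod K) ≡⟨ toℕ-fromℕ< _ ⟩
    (n * K + toℕ t) % K         ≡⟨ %-remove-+ˡ (toℕ t) (n∣m*n n) ⟩
    toℕ t % K                   ≡⟨ m<n⇒m%n≡m (toℕ<n t) ⟩
    toℕ t                       ∎)
    where open ≡-Reasoning

  name-names : ∀ s → (VecSpace K ACCInput names name s) (input s)
  name-names s t =
    subst (ACCInput names _) (sym (lookup∘tabulate (mapMaybe proj₂ ∘ s) t))
      (enumeration-names (s t) (λ i → i * K + toℕ t)
        (λ i → ≤-trans (m≤m*n i K) (m≤m+n _ _))
        (λ i → cong (λ u → enumeration (s u) (i * K + toℕ t)) (component-mod i t)))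

  settle : State → Fin K → ℕ → ℕ → State
  settle s i B y = updateAt s i (const (just (B , y)))

  name-settle-agree : ∀ s {i B y} → s i ≡ nothing → Agree B (name s) (name (settle s i B y))
  name-settle-agree s {i} {B} {y} si≡nothing n n<B with n mod K ≟ i
  ... | yes refl = begin
    enumeration (s i) n                 ≡⟨ cong (λ v → enumeration v n) si≡nothing ⟩
    0                                   ≡⟨ enumeration-below n<B ⟨
    enumeration (just (B , y)) n        ≡⟨ cong (λ v → enumeration v n) (updateAt-updates i s) ⟨
    enumeration (settle s i B y i) n    ∎
    where open ≡-Reasoning
  ... | no other = cong (λ v → enumeration v n) (sym (updateAt-minimal _ i s other))

  -- Each settled guess j is forced to be wrong: its coordinate j is the value m that
  -- instance j excludes.
  Invariant : State → ℕ → Set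
  Invariant s B = ∀ j M m → s j ≡ just (M , m) → Forces c B (name s) j m

  invariant-settle : ∀ {s B i U y} → Invariant s B → s i ≡ nothing → Forces c U (name s) i y →
                     Invariant (settle s i (B ⊔ U) y) (B ⊔ U)
  invariant-settle {s} {B} {i} {U} inv si≡nothing forces j M m sj≡ with j ≟ i
  ... | yes refl with trans (sym (updateAt-updates j s)) sj≡
  ...   | refl = forces-weaken c forces (m≤n⊔m B U) (name-settle-agree s si≡nothing)
  invariant-settle {s} {B} {i} {U} inv si≡nothing forces j M m sj≡ | no j≢i =
    forces-weaken c (inv j M m (trans (sym (updateAt-minimal j i s j≢i)) sj≡)) (m≤m⊔n B U)
      (name-settle-agree s si≡nothing)

  correct-guess-forced : ∀ {s B} → Invariant s B →
                         Σ (Fin K) λ i → s i ≡ nothing × Σ ℕ λ U → Σ ℕ λ y → Forces c U (name s) i y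
  correct-guess-forced {s} inv
    with realizes (input s) (name s) (λ _ → tt) (name-names s)
  ... | q , out , _ , (i , ys , guess-i≡ , correct) , guesses-named
    with subst (Completion (VecSpace K ℕSpace) names component q i) guess-i≡ (guesses-named i)
  ... | r , decodes , r-names with s i in si≡
  ... | nothing = let U , forces = decoded-guess-forced c i out decodes in i , si≡ , U , _ , forces
  ... | just (M , m) = ⊥-elim (correct i (begin
    lookup (input s) i      ≡⟨ lookup∘tabulate (mapMaybe proj₂ ∘ s) i ⟩
    mapMaybe proj₂ (s i)    ≡⟨ cong (mapMaybe proj₂) si≡ ⟩
    just m                  ≡⟨ cong just (inv i M m si≡ (name s) q r (λ _ _ → refl) out decodes) ⟨
    just (r (toℕ i))        ≡⟨ cong just (r-names i) ⟩
    just (lookup ys i)      ∎))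
    where open ≡-Reasoning

  refute : ∀ s B → Acc _<_ (countNothing s) → ¬ Invariant s B
  refute s B (acc smaller) inv with correct-guess-forced inv
  ... | i , si≡nothing , U , y , forces =
    refute (settle s i (B ⊔ U) y) (B ⊔ U) (smaller (countNothing-updateAt s i si≡nothing))
      (invariant-settle inv si≡nothing forces)

  contradiction : ⊥
  contradiction = refute (const nothing) 0 (<-wellFounded _) (λ _ _ _ ())

proposition6 : (k : ℕ) → ¬ Guessable k (ACC^ k)
proposition6 zero (c , realizes) with realizes [] (λ _ → 0) (λ ()) (λ ())
... | _ , _ , _ , (() , _) , _
proposition6 (suc k) guesser = Diagonal.contradiction (suc k) guesser
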